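{- Let $G=(V,E)$ be a finite simple chordal graph. Then for every integer $k\ge 2$, the total $k$-cut complex $\Delta_k^t(G)$ is vertex decomposable, and therefore shellable.
   Context: A graph is chordal if it contains no induced cycle with more than 3 vertices. A set $S\subseteq V$ is independent if no two vertices of $S$ form an edge. For $k\ge 1$, the total $k$-cut complex $\Delta_k^t(G)$ is the simplicial complex whose facets are the sets $V\setminus S$ with $S$ an independent set of $G$ of size $k$; equivalently $\sigma\subseteq V$ is a face iff $V\setminus\sigma$ contains an independent set of size $k$. If $G$ has no independent set of size $k$, $\Delta_k^t(G)$ is the void complex (no faces at all, not even $\emptyset$). A $d$-dimensional simplicial complex $\Delta$ is vertex decomposable if either $\Delta$ is a simplex, or there is a vertex $v$ such that $\mathrm{lk}_\Delta v=\{\tau\in\Delta: v\notin\tau,\ \tau\cup\{v\}\in\Delta\}$ and $\mathrm{del}_\Delta v=\{\tau\in\Delta: v\notin\tau\}$ are both vertex decomposable and $\mathrm{del}_\Delta v$ is pure of dimension $d$. By convention the void complex is considered vertex decomposable and shellable. -}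

module Defs where

open import Data.Nat using (ℕ; zero; suc; _≤_; _∸_)
open import Data.Fin using (Fin; toℕ)
open import Data.Fin.Subset using (Subset; _∈_; _∉_; _⊆_; ∁; _∪_; ⁅_⁆; ∣_∣)
open import Data.Bool using (Bool; true)
open import Data.Product using (Σ; _×_; ∃)
open import Data.Sum using (_⊎_)
open import Data.List using (List; []; _∷_)
open import Data.List.Relation.Unary.All using (All)
open import Data.List.Relation.Unary.Any using (Any)
open import Data.List.Relation.Unary.Unique.Propositional using (Unique)
open import Data.List.Membership.Propositional using () renaming (_∈_ to _∈ˡ_)
open import Data.Unit using (⊤)
open import Relation.Nullary using (¬_)
open import Relation.Binary.PropositionalEquality using (_≡_)
open import Function.Definitions using (Injective)
open import Function.Bundles using (_⇔_)

record Graph (n : ℕ) : Set where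
  field
    adj   : Fin n → Fin n → Bool
    sym   : ∀ i j → adj i j ≡ adj j i
    irrefl : ∀ i → ¬ (adj i i ≡ true)

open Graph public

Edge : ∀ {n} → Graph n → Fin n → Fin n → Set
Edge G i j = adj G i j ≡ true

CycAdj : (m : ℕ) → Fin m → Fin m → Set
CycAdj m i j =
  suc (toℕ i) ≡ toℕ j ⊎ suc (toℕ j) ≡ toℕ i
  ⊎ (toℕ i ≡ 0 × suc (toℕ j) ≡ m) ⊎ (toℕ j ≡ 0 × suc (toℕ i) ≡ m)

InducedCycle : ∀ {n} → Graph n → (m : ℕ) → (Fin m → Fin n) → Set
InducedCycle G m c = Injective _≡_ _≡_ c × (∀ i j → Edge G (c i) (c j) ⇔ CycAdj m i j)

Chordal : ∀ {n} → Graph n → Set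
Chordal {n} G = ∀ m → 4 ≤ m → (c : Fin m → Fin n) → ¬ InducedCycle G m c

Independent : ∀ {n} → Graph n → Subset n → Set
Independent G S = ∀ i j → i ∈ S → j ∈ S → ¬ Edge G i j

Complex : ℕ → Set₁
Complex n = Subset n → Set

TotalCut : ∀ {n} → ℕ → Graph n → Complex n
TotalCut k G σ = Σ _ λ S → Independent G S × ∣ S ∣ ≡ k × S ⊆ ∁ σ

lk : ∀ {n} → Complex n → Fin n → Complex n
lk Δ v τ = v ∉ τ × Δ (τ ∪ ⁅ v ⁆)

del : ∀ {n} → Complex n → Fin n → Complex n
del Δ v τ = v ∉ τ × Δ τ

Void : ∀ {n} → Complex n → Set
Void Δ = ∀ σ → ¬ Δ σ

IsSimplex : ∀ {n} → Complex n → Set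
IsSimplex {n} Δ = Σ (Subset n) λ F → ∀ σ → Δ σ ⇔ σ ⊆ F

-- Largest face has exactly s vertices (i.e. dim Δ = s - 1)
MaxFaceSize : ∀ {n} → Complex n → ℕ → Set
MaxFaceSize Δ s = (∃ λ τ → Δ τ × ∣ τ ∣ ≡ s) × (∀ τ → Δ τ → ∣ τ ∣ ≤ s)

PureOfSize : ∀ {n} → Complex n → ℕ → Set
PureOfSize Δ s = (∀ σ → Δ σ → ∃ λ τ → Δ τ × σ ⊆ τ × ∣ τ ∣ ≡ s) × (∀ τ → Δ τ → ∣ τ ∣ ≤ s)

-- Vertex decomposability (void complexes are vertex decomposable by convention).
data VertexDecomposable {n : ℕ} : Complex n → Set₁ where
  void    : ∀ {Δ} → Void Δ → VertexDecomposable Δ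
  simplex : ∀ {Δ} → IsSimplex Δ → VertexDecomposable Δ
  decomp  : ∀ {Δ} (s : ℕ) → MaxFaceSize Δ s → (v : Fin n) → Δ ⁅ v ⁆ →
            VertexDecomposable (lk Δ v) → VertexDecomposable (del Δ v) →
            PureOfSize (del Δ v) s → VertexDecomposable Δ

IsFacet : ∀ {n} → Complex n → Subset n → Set
IsFacet Δ F = Δ F × (∀ τ → Δ τ → F ⊆ τ → τ ≡ F)

Gen : ∀ {n} → List (Subset n) → Complex n
Gen L σ = Any (σ ⊆_) L

-- shelling condition for an ordering F₁,…,Fₘ (prev = earlier facets, reversed):
-- for j ≥ 2, ⟨Fⱼ⟩ ∩ ⟨F₁,…,Fⱼ₋₁⟩ is pure of dimension dim Fⱼ - 1.
ShellCond : ∀ {n} → List (Subset n) → List (Subset n) → Set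
ShellCond prev [] = ⊤
ShellCond [] (F ∷ rest) = ShellCond (F ∷ []) rest
ShellCond prev@(_ ∷ _) (F ∷ rest) =
  PureOfSize (λ σ → σ ⊆ F × Gen prev σ) (∣ F ∣ ∸ 1) × ShellCond (F ∷ prev) rest

-- (Not necessarily pure) shellability: a linear order of all facets satisfying
-- the shelling condition. The void complex has the empty shelling.
Shellable : ∀ {n} → Complex n → Set
Shellable {n} Δ = Σ (List (Subset n)) λ L →
  All (IsFacet Δ) L × (∀ F → IsFacet Δ F → F ∈ˡ L) × Unique L × ShellCond [] L

-- A simplicial vertex v of G[W] is a shedding vertex of the complex Δ(V, W, k) of the sets
-- τ ⊆ V whose complement contains an independent k-set of G inside W. Its link is Δ(V - v, W - v, k)
-- and its deletion is Δ(V - v, W ∖ N[v], k - 1), since an independent set in W meets N[v] at most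
-- once, N(v) ∩ W being a clique. The total cut complex is Δ(V, V, k), and by Dirac's lemma every
-- nonempty vertex set W of a chordal graph contains a simplicial vertex of G[W], so induction on |W|
-- gives vertex decomposability. As usual, a shelling of the deletion followed by the cones over a
-- shelling of the link is a shelling, so vertex decomposable complexes are shellable.
module Submission where

open import Defs hiding (sym)
open import Data.Nat using (ℕ; zero; suc; _+_; _∸_; _≤_; _<_; _≤′_; ≤′-refl; ≤′-step; z≤n; s≤s; _≟_; _≤?_)
open import Data.Nat.Properties
open import Data.Fin using (Fin; zero; suc; toℕ)
open import Data.Fin.Properties using (all?; any?; toℕ-injective; toℕ<n)
open import Data.Fin.Subset
open import Data.Fin.Subset.Properties
open import Data.Vec using ([]; _∷_; here; there; tabulate)
open import Data.Vec.Properties using (lookup∘tabulate; []=⇒lookup; lookup⇒[]=)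
open import Data.Bool using (Bool; true)
open import Data.Product using (Σ; _×_; _,_; proj₁; proj₂; ∃)
open import Data.Product.Function.NonDependent.Propositional using (_×-⇔_)
open import Data.Sum using (_⊎_; inj₁; inj₂; [_,_]′)
open import Data.Sum.Function.Propositional using (_⊎-⇔_)
open import Data.Unit using (tt)
import Data.Unit
import Data.Empty
open import Relation.Nullary using (¬_; Dec; does; yes; no; contradiction; ¬?; _→-dec_; _×-dec_)
open import Relation.Binary.Definitions using (tri<; tri≈; tri>)
open import Relation.Binary.PropositionalEquality using (_≡_; _≢_; refl; sym; trans; cong; cong₂; subst; subst₂)
open import Function.Base using (_∘_)
open import Function.Bundles using (_⇔_; mk⇔; Equivalence)
import Function.Properties.Equivalence as ⇔
open import Data.List using (List; []; _∷_; _++_; map; foldl)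
open import Data.List.Properties using (map-∘; map-id-local)
open import Data.List.Relation.Unary.All as All using (All; []; _∷_)
import Data.List.Relation.Unary.All.Properties as All
open import Data.List.Relation.Unary.Any using (Any; here; there)
open import Data.List.Relation.Unary.AllPairs using ([]; _∷_)
open import Data.List.Relation.Unary.Unique.Propositional using (Unique)
import Data.List.Relation.Unary.Unique.Propositional.Properties as Unique
open import Data.List.Membership.Propositional using (find; lose) renaming (_∈_ to _∈ˡ_; _∉_ to _∉ˡ_)
open import Data.List.Membership.Propositional.Properties using (∈-++⁺ˡ; ∈-++⁺ʳ; ∈-map⁺; ∈-map⁻)

open Equivalence using (to; from)

variable
  n : ℕ

x∈p─q⇒x∉q : ∀ {p q : Subset n} {x} → x ∈ p ─ q → x ∉ q
x∈p─q⇒x∉q {p = s ∷ p} {q = inside ∷ q} () here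
x∈p─q⇒x∉q {p = s ∷ p} {q = t ∷ q} (there x∈p─q) (there x∈q) = x∈p─q⇒x∉q x∈p─q x∈q

∣p∣≡∣p∩q∣+∣p─q∣ : ∀ (p q : Subset n) → ∣ p ∣ ≡ ∣ p ∩ q ∣ + ∣ p ─ q ∣
∣p∣≡∣p∩q∣+∣p─q∣ [] [] = refl
∣p∣≡∣p∩q∣+∣p─q∣ (inside ∷ p) (inside ∷ q) = cong suc (∣p∣≡∣p∩q∣+∣p─q∣ p q)
∣p∣≡∣p∩q∣+∣p─q∣ (inside ∷ p) (outside ∷ q) =
  trans (cong suc (∣p∣≡∣p∩q∣+∣p─q∣ p q)) (sym (+-suc ∣ p ∩ q ∣ ∣ p ─ q ∣))
∣p∣≡∣p∩q∣+∣p─q∣ (outside ∷ p) (inside ∷ q) = ∣p∣≡∣p∩q∣+∣p─q∣ p q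
∣p∣≡∣p∩q∣+∣p─q∣ (outside ∷ p) (outside ∷ q) = ∣p∣≡∣p∩q∣+∣p─q∣ p q

∣p∣≡∣q∣+∣p─q∣ : ∀ {p q : Subset n} → q ⊆ p → ∣ p ∣ ≡ ∣ q ∣ + ∣ p ─ q ∣
∣p∣≡∣q∣+∣p─q∣ {p = p} {q = q} q⊆p = trans (∣p∣≡∣p∩q∣+∣p─q∣ p q) (cong (λ r → ∣ r ∣ + ∣ p ─ q ∣) p∩q≡q)
  where
  p∩q≡q : p ∩ q ≡ q
  p∩q≡q = ⊆-antisym (p∩q⊆q p q) (λ x∈q → x∈p∩q⁺ (q⊆p x∈q , x∈q))

∣p─q∣≡∣p∣∸∣q∣ : ∀ {p q : Subset n} → q ⊆ p → ∣ p ─ q ∣ ≡ ∣ p ∣ ∸ ∣ q ∣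
∣p─q∣≡∣p∣∸∣q∣ {p = p} {q = q} q⊆p =
  trans (sym (m+n∸m≡n ∣ q ∣ ∣ p ─ q ∣)) (cong (_∸ ∣ q ∣) (sym (∣p∣≡∣q∣+∣p─q∣ q⊆p)))

p⊆q∧∣q∣≤∣p∣⇒p≡q : ∀ {p q : Subset n} → p ⊆ q → ∣ q ∣ ≤ ∣ p ∣ → p ≡ q
p⊆q∧∣q∣≤∣p∣⇒p≡q {p = p} {q = q} p⊆q ∣q∣≤∣p∣ = ⊆-antisym p⊆q q⊆p
  where
  q⊆p : q ⊆ p
  q⊆p {x} x∈q with x ∈? p
  ... | yes x∈p = x∈p
  ... | no x∉p = contradiction (p⊂q⇒∣p∣<∣q∣ (p⊆q , x , x∈q , x∉p)) (≤⇒≯ ∣q∣≤∣p∣)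

⊆-ofSize : ∀ (p : Subset n) m → m ≤ ∣ p ∣ → ∃ λ q → q ⊆ p × ∣ q ∣ ≡ m
⊆-ofSize {n} p zero _ = ⊥ , (λ x∈⊥ → contradiction x∈⊥ ∉⊥) , ∣⊥∣≡0 n
⊆-ofSize (inside ∷ p) (suc m) (s≤s m≤∣p∣) with ⊆-ofSize p m m≤∣p∣
... | q , q⊆p , ∣q∣≡m = inside ∷ q , s⊆s q⊆p , cong suc ∣q∣≡m
⊆-ofSize (outside ∷ p) (suc m) m<∣p∣ with ⊆-ofSize p (suc m) m<∣p∣
... | q , q⊆p , ∣q∣≡m = outside ∷ q , s⊆s q⊆p , ∣q∣≡m

∣p∣≤1 : ∀ (p : Subset n) → (∀ {x y} → x ∈ p → y ∈ p → x ≡ y) → ∣ p ∣ ≤ 1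
∣p∣≤1 {n} p unique with nonempty? p
... | yes (x , x∈p) =
  subst (∣ p ∣ ≤_) (∣⁅x⁆∣≡1 x) (p⊆q⇒∣p∣≤∣q∣ (λ y∈p → subst (_∈ ⁅ x ⁆) (unique x∈p y∈p) (x∈⁅x⁆ x)))
... | no empty = subst (_≤ 1) (sym (trans (cong ∣_∣ (Empty-unique empty)) (∣⊥∣≡0 n))) z≤n

x∈p∪⁅x⁆ : ∀ (p : Subset n) x → x ∈ p ∪ ⁅ x ⁆
x∈p∪⁅x⁆ p x = x∈p∪q⁺ (inj₂ (x∈⁅x⁆ x))

x∈p∪⁅y⁆⁻ : ∀ (p : Subset n) y {x} → x ∈ p ∪ ⁅ y ⁆ → x ∈ p ⊎ x ≡ y
x∈p∪⁅y⁆⁻ p y x∈ = Data.Sum.map₂ (x∈⁅y⁆⇒x≡y y) (x∈p∪q⁻ p ⁅ y ⁆ x∈)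

x∈p-y⁻ : ∀ {p : Subset n} {x y} → x ∈ p - y → x ∈ p × x ≢ y
x∈p-y⁻ {p = p} {y = y} x∈ = p─q⊆p p ⁅ y ⁆ x∈ , x∉⁅y⁆⇒x≢y (x∈p─q⇒x∉q x∈)

x∉p-x : ∀ (p : Subset n) x → x ∉ p - x
x∉p-x p x x∈ = proj₂ (x∈p-y⁻ x∈) refl

p∪⁅x⁆-x≡p : ∀ {p : Subset n} {x} → x ∉ p → (p ∪ ⁅ x ⁆) - x ≡ p
p∪⁅x⁆-x≡p {p = p} {x = x} x∉p = ⊆-antisym ⊆p (λ y∈p → x∈p∧x≢y⇒x∈p-y (p⊆p∪q ⁅ x ⁆ y∈p) (λ { refl → x∉p y∈p }))
  where
  ⊆p : (p ∪ ⁅ x ⁆) - x ⊆ p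
  ⊆p y∈ with x∈p-y⁻ y∈
  ... | y∈p∪x , y≢x = [ (λ y∈p → y∈p) , (λ y≡x → contradiction y≡x y≢x) ]′ (x∈p∪⁅y⁆⁻ p x y∈p∪x)

p-x∪⁅x⁆≡p : ∀ {p : Subset n} {x} → x ∈ p → (p - x) ∪ ⁅ x ⁆ ≡ p
p-x∪⁅x⁆≡p {p = p} {x = x} x∈p = ⊆-antisym ⊆p p⊆
  where
  ⊆p : (p - x) ∪ ⁅ x ⁆ ⊆ p
  ⊆p y∈ = [ (λ y∈p-x → proj₁ (x∈p-y⁻ y∈p-x)) , (λ { refl → x∈p }) ]′ (x∈p∪⁅y⁆⁻ (p - x) x y∈)
  p⊆ : p ⊆ (p - x) ∪ ⁅ x ⁆
  p⊆ {y} y∈p with y Data.Fin.≟ x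
  ... | yes refl = x∈p∪⁅x⁆ (p - x) x
  ... | no y≢x = p⊆p∪q ⁅ x ⁆ (x∈p∧x≢y⇒x∈p-y y∈p y≢x)

∣p∪⁅x⁆∣≡1+∣p∣ : ∀ {p : Subset n} {x} → x ∉ p → ∣ p ∪ ⁅ x ⁆ ∣ ≡ suc ∣ p ∣
∣p∪⁅x⁆∣≡1+∣p∣ {p = p} {x = x} x∉p = begin
  ∣ p ∪ ⁅ x ⁆ ∣                          ≡⟨ ∣p∣≡∣q∣+∣p─q∣ (q⊆p∪q p ⁅ x ⁆) ⟩
  ∣ ⁅ x ⁆ ∣ + ∣ (p ∪ ⁅ x ⁆) - x ∣          ≡⟨ cong₂ _+_ (∣⁅x⁆∣≡1 x) (cong ∣_∣ (p∪⁅x⁆-x≡p x∉p)) ⟩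
  suc ∣ p ∣                              ∎
  where open Relation.Binary.PropositionalEquality.≡-Reasoning

∣p∣≡1+∣p-x∣ : ∀ {p : Subset n} {x} → x ∈ p → ∣ p ∣ ≡ suc ∣ p - x ∣
∣p∣≡1+∣p-x∣ {p = p} {x = x} x∈p =
  trans (cong ∣_∣ (sym (p-x∪⁅x⁆≡p x∈p))) (∣p∪⁅x⁆∣≡1+∣p∣ (x∉p-x p x))

∣p∣≤1+∣p-x∣ : ∀ (p : Subset n) x → ∣ p ∣ ≤ suc ∣ p - x ∣
∣p∣≤1+∣p-x∣ p x with x ∈? p
... | yes x∈p = ≤-reflexive (∣p∣≡1+∣p-x∣ x∈p)
... | no x∉p = m≤n⇒m≤1+n (p⊆q⇒∣p∣≤∣q∣ {p = p} {q = p - x} (λ y∈p → x∈p∧x≢y⇒x∈p-y y∈p (λ { refl → x∉p y∈p })))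

⊆∪⁅x⁆⇒-x⊆ : ∀ {σ τ : Subset n} {x} → σ ⊆ τ ∪ ⁅ x ⁆ → σ - x ⊆ τ
⊆∪⁅x⁆⇒-x⊆ {τ = τ} {x = x} σ⊆ y∈ with x∈p-y⁻ y∈
... | y∈σ , y≢x = [ (λ y∈τ → y∈τ) , (λ y≡x → contradiction y≡x y≢x) ]′ (x∈p∪⁅y⁆⁻ τ x (σ⊆ y∈σ))

-x⊆⇒⊆∪⁅x⁆ : ∀ {σ τ : Subset n} {x} → σ - x ⊆ τ → σ ⊆ τ ∪ ⁅ x ⁆
-x⊆⇒⊆∪⁅x⁆ {τ = τ} {x = x} σ-x⊆τ {y} y∈σ with y Data.Fin.≟ x
... | yes refl = x∈p∪⁅x⁆ τ x
... | no y≢x = p⊆p∪q ⁅ x ⁆ (σ-x⊆τ (x∈p∧x≢y⇒x∈p-y y∈σ y≢x))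

⊆∪⁅x⁆∧x∉⇒⊆ : ∀ {σ τ : Subset n} {x} → σ ⊆ τ ∪ ⁅ x ⁆ → x ∉ σ → σ ⊆ τ
⊆∪⁅x⁆∧x∉⇒⊆ {τ = τ} {x = x} σ⊆ x∉σ y∈σ =
  [ (λ y∈τ → y∈τ) , (λ { refl → contradiction y∈σ x∉σ }) ]′ (x∈p∪⁅y⁆⁻ τ x (σ⊆ y∈σ))

x∈tabulate⇔ : ∀ {f : Fin n → Bool} {x} → x ∈ tabulate f ⇔ f x ≡ true
x∈tabulate⇔ {f = f} {x} = mk⇔ (λ x∈ → trans (sym (lookup∘tabulate f x)) ([]=⇒lookup x∈))
                              (λ fx≡true → lookup⇒[]= x (tabulate f) (trans (lookup∘tabulate f x) fx≡true))

does≡true⇔ : ∀ {A : Set} (a? : Dec A) → does a? ≡ true ⇔ A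
does≡true⇔ (yes a) = mk⇔ (λ _ → a) (λ _ → refl)
does≡true⇔ (no ¬a) = mk⇔ (λ ()) (λ a → contradiction a ¬a)

toSubset : ∀ {P : Fin n → Set} → (∀ x → Dec (P x)) → Subset n
toSubset P? = tabulate (does ∘ P?)

x∈toSubset⇔ : ∀ {P : Fin n → Set} (P? : ∀ x → Dec (P x)) {x} → x ∈ toSubset P? ⇔ P x
x∈toSubset⇔ P? {x} = ⇔.trans x∈tabulate⇔ (does≡true⇔ (P? x))

p⊆q⇒p∪r⊆q∪r : ∀ {p q : Subset n} r → p ⊆ q → p ∪ r ⊆ q ∪ r
p⊆q⇒p∪r⊆q∪r {p = p} {q} r p⊆q x∈p∪r = [ p⊆p∪q r ∘ p⊆q , q⊆p∪q q r ]′ (x∈p∪q⁻ p r x∈p∪r)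

p⊆r∧s⊆q⇒p─q⊆r─s : ∀ {p q r s : Subset n} → p ⊆ r → s ⊆ q → p ─ q ⊆ r ─ s
p⊆r∧s⊆q⇒p─q⊆r─s {p = p} {q} p⊆r s⊆q x∈p─q = x∈p∧x∉q⇒x∈p─q (p⊆r (p─q⊆p p q x∈p─q)) (x∈p─q⇒x∉q x∈p─q ∘ s⊆q)

p⊆q∧x∉p⇒p⊆q-x : ∀ {p q : Subset n} {x} → p ⊆ q → x ∉ p → p ⊆ q - x
p⊆q∧x∉p⇒p⊆q-x p⊆q x∉p y∈p = x∈p∧x≢y⇒x∈p-y (p⊆q y∈p) (λ { refl → x∉p y∈p })

_≋_ : Complex n → Complex n → Set
Δ ≋ Δ′ = ∀ σ → Δ σ ⇔ Δ′ σ

≋-sym : ∀ {Δ Δ′ : Complex n} → Δ ≋ Δ′ → Δ′ ≋ Δ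
≋-sym Δ≋Δ′ σ = ⇔.sym (Δ≋Δ′ σ)

≋-trans : ∀ {Δ Δ′ Δ″ : Complex n} → Δ ≋ Δ′ → Δ′ ≋ Δ″ → Δ ≋ Δ″
≋-trans Δ≋Δ′ Δ′≋Δ″ σ = ⇔.trans (Δ≋Δ′ σ) (Δ′≋Δ″ σ)

DownClosed : Complex n → Set
DownClosed Δ = ∀ {σ τ} → σ ⊆ τ → Δ τ → Δ σ

noFaces : Complex n
noFaces _ = Data.Empty.⊥

lk-resp : ∀ {Δ Δ′ : Complex n} v → Δ ≋ Δ′ → lk Δ v ≋ lk Δ′ v
lk-resp v Δ≋Δ′ σ = ⇔.refl ×-⇔ Δ≋Δ′ (σ ∪ ⁅ v ⁆)

del-resp : ∀ {Δ Δ′ : Complex n} v → Δ ≋ Δ′ → del Δ v ≋ del Δ′ v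
del-resp v Δ≋Δ′ σ = ⇔.refl ×-⇔ Δ≋Δ′ σ

PureOfSize-resp : ∀ {Δ Δ′ : Complex n} {s} → Δ ≋ Δ′ → PureOfSize Δ s → PureOfSize Δ′ s
PureOfSize-resp {Δ′ = Δ′} {s} Δ≋Δ′ (extend , bound) = extend′ , λ τ → bound τ ∘ from (Δ≋Δ′ τ)
  where
  extend′ : ∀ σ → Δ′ σ → ∃ λ τ → Δ′ τ × σ ⊆ τ × ∣ τ ∣ ≡ s
  extend′ σ Δ′σ with extend σ (from (Δ≋Δ′ σ) Δ′σ)
  ... | τ , Δτ , σ⊆τ , ∣τ∣≡s = τ , to (Δ≋Δ′ τ) Δτ , σ⊆τ , ∣τ∣≡s

PureOfSize-noFaces : ∀ {Δ : Complex n} {s} → (∀ σ → ¬ Δ σ) → PureOfSize Δ s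
PureOfSize-noFaces none = (λ σ Δσ → contradiction Δσ (none σ)) , (λ τ Δτ → contradiction Δτ (none τ))

PureOfSize⇒MaxFaceSize : ∀ {Δ : Complex n} {s σ} → PureOfSize Δ s → Δ σ → MaxFaceSize Δ s
PureOfSize⇒MaxFaceSize (extend , bound) Δσ with extend _ Δσ
... | τ , Δτ , _ , ∣τ∣≡s = (τ , Δτ , ∣τ∣≡s) , bound

nonvertex⇒≋del : ∀ {Δ : Complex n} {v} → DownClosed Δ → ¬ Δ ⁅ v ⁆ → Δ ≋ del Δ v
nonvertex⇒≋del {v = v} closed v∉Δ σ =
  mk⇔ (λ Δσ → (λ v∈σ → v∉Δ (closed (λ x∈⁅v⁆ → subst (_∈ σ) (sym (x∈⁅y⁆⇒x≡y v x∈⁅v⁆)) v∈σ) Δσ)) , Δσ) proj₂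

VertexDecomposable-resp : ∀ {Δ Δ′ : Complex n} → Δ ≋ Δ′ → VertexDecomposable Δ → VertexDecomposable Δ′
VertexDecomposable-resp Δ≋Δ′ (void none) = void (λ σ → none σ ∘ from (Δ≋Δ′ σ))
VertexDecomposable-resp Δ≋Δ′ (simplex (F , faces)) = simplex (F , λ σ → ⇔.trans (⇔.sym (Δ≋Δ′ σ)) (faces σ))
VertexDecomposable-resp Δ≋Δ′ (decomp s ((τ , Δτ , ∣τ∣≡s) , bound) v Δv lkVD delVD delPure) =
  decomp s ((τ , to (Δ≋Δ′ τ) Δτ , ∣τ∣≡s) , λ ρ → bound ρ ∘ from (Δ≋Δ′ ρ)) v (to (Δ≋Δ′ ⁅ v ⁆) Δv)
    (VertexDecomposable-resp (lk-resp v Δ≋Δ′) lkVD)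
    (VertexDecomposable-resp (del-resp v Δ≋Δ′) delVD)
    (PureOfSize-resp (del-resp v Δ≋Δ′) delPure)

lk-closed : ∀ {Δ : Complex n} v → DownClosed Δ → DownClosed (lk Δ v)
lk-closed v closed σ⊆τ (v∉τ , Δτ∪v) = v∉τ ∘ σ⊆τ , closed (p⊆q⇒p∪r⊆q∪r ⁅ v ⁆ σ⊆τ) Δτ∪v

del-closed : ∀ {Δ : Complex n} v → DownClosed Δ → DownClosed (del Δ v)
del-closed v closed σ⊆τ (v∉τ , Δτ) = v∉τ ∘ σ⊆τ , closed σ⊆τ Δτ

maximumSize⇒facet : ∀ {Δ : Complex n} {s τ} → (∀ ρ → Δ ρ → ∣ ρ ∣ ≤ s) → Δ τ → ∣ τ ∣ ≡ s → IsFacet Δ τ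
maximumSize⇒facet bound Δτ ∣τ∣≡s = Δτ , λ ρ Δρ τ⊆ρ →
  sym (p⊆q∧∣q∣≤∣p∣⇒p≡q τ⊆ρ (subst (_ ≤_) (sym ∣τ∣≡s) (bound ρ Δρ)))

addFacet : Complex n → Subset n → Complex n
addFacet Π F σ = σ ⊆ F ⊎ Π σ

addFacet-resp : ∀ {Π Π′ : Complex n} F → Π ≋ Π′ → addFacet Π F ≋ addFacet Π′ F
addFacet-resp F Π≋Π′ σ = ⇔.refl ⊎-⇔ Π≋Π′ σ

Gen-∷ : ∀ (F : Subset n) L → Gen (F ∷ L) ≋ addFacet (Gen L) F
Gen-∷ F L σ = mk⇔ (λ { (here σ⊆F) → inj₁ σ⊆F ; (there σ∈⟨L⟩) → inj₂ σ∈⟨L⟩ }) [ here , there ]′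

foldl-addFacet : ∀ {Π : Complex n} L σ → foldl addFacet Π L σ ⇔ (Π σ ⊎ Gen L σ)
foldl-addFacet [] σ = mk⇔ inj₁ [ (λ Πσ → Πσ) , (λ ()) ]′
foldl-addFacet (F ∷ L) σ = ⇔.trans (foldl-addFacet L σ)
  (mk⇔ [ [ inj₂ ∘ here , inj₁ ]′ , inj₂ ∘ there ]′
       [ inj₁ ∘ inj₂ , (λ { (here σ⊆F) → inj₁ (inj₁ σ⊆F) ; (there σ∈⟨L⟩) → inj₂ σ∈⟨L⟩ }) ]′)

ShellingAfter : Complex n → List (Subset n) → Set
ShellingAfter Π [] = Data.Unit.⊤
ShellingAfter Π (F ∷ L) = PureOfSize (λ σ → σ ⊆ F × Π σ) (∣ F ∣ ∸ 1) × ShellingAfter (addFacet Π F) L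

ShellCond⇔ShellingAfter : ∀ {Π : Complex n} prev L → Gen prev ≋ Π → ShellCond prev L ⇔ ShellingAfter Π L
ShellCond⇔ShellingAfter prev [] _ = mk⇔ (λ _ → tt) (λ _ → tt)
ShellCond⇔ShellingAfter {Π = Π} [] (F ∷ L) ⟨[]⟩≋Π =
  mk⇔ (λ shellCond → PureOfSize-noFaces noFace , to rest shellCond) (from rest ∘ proj₂)
  where
  noFace : ∀ σ → ¬ (σ ⊆ F × Π σ)
  noFace σ (_ , Πσ) with from (⟨[]⟩≋Π σ) Πσ
  ... | ()
  rest : ShellCond (F ∷ []) L ⇔ ShellingAfter (addFacet Π F) L
  rest = ShellCond⇔ShellingAfter (F ∷ []) L (λ σ → ⇔.trans (Gen-∷ F [] σ) (addFacet-resp F ⟨[]⟩≋Π σ))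
ShellCond⇔ShellingAfter {Π = Π} (P ∷ prev) (F ∷ L) ⟨prev⟩≋Π =
  mk⇔ (PureOfSize-resp faces≋) (PureOfSize-resp (≋-sym faces≋)) ×-⇔
  ShellCond⇔ShellingAfter (F ∷ P ∷ prev) L (λ σ → ⇔.trans (Gen-∷ F (P ∷ prev) σ) (addFacet-resp F ⟨prev⟩≋Π σ))
  where
  faces≋ : (λ σ → σ ⊆ F × Gen (P ∷ prev) σ) ≋ (λ σ → σ ⊆ F × Π σ)
  faces≋ = λ σ → ⇔.refl ×-⇔ ⟨prev⟩≋Π σ

ShellingAfter-++ : ∀ {Π : Complex n} L {M} →
  ShellingAfter Π L → ShellingAfter (foldl addFacet Π L) M → ShellingAfter Π (L ++ M)
ShellingAfter-++ [] _ shellingM = shellingM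
ShellingAfter-++ (F ∷ L) (pure , shellingL) shellingM = pure , ShellingAfter-++ L shellingL shellingM

Fresh : Complex n → List (Subset n) → Set
Fresh Π [] = Data.Unit.⊤
Fresh Π (τ ∷ L) = ¬ Π τ × Fresh (addFacet Π τ) L

facets-fresh : ∀ {Λ Π : Complex n} L → All (IsFacet Λ) L → Unique L →
  (∀ {σ} → Π σ → ∃ λ F → IsFacet Λ F × σ ⊆ F × F ∉ˡ L) → Fresh Π L
facets-fresh [] _ _ _ = tt
facets-fresh {Λ = Λ} {Π} (τ ∷ L) (τ-facet ∷ facets) (τ∉L ∷ unique) below =
  τ∉Π , facets-fresh L facets unique below′
  where
  τ∉Π : ¬ Π τ
  τ∉Π Πτ with below Πτ
  ... | F , (ΛF , _) , τ⊆F , F∉τ∷L = F∉τ∷L (here (proj₂ τ-facet F ΛF τ⊆F))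
  below′ : ∀ {σ} → addFacet Π τ σ → ∃ λ F → IsFacet Λ F × σ ⊆ F × F ∉ˡ L
  below′ (inj₁ σ⊆τ) = τ , τ-facet , σ⊆τ , All.All¬⇒¬Any τ∉L
  below′ (inj₂ Πσ) with below Πσ
  ... | F , F-facet , σ⊆F , F∉τ∷L = F , F-facet , σ⊆F , F∉τ∷L ∘ there

⊆∪⁅x⁆⇔-x⊆ : ∀ {σ τ : Subset n} {x} → (σ ⊆ τ ∪ ⁅ x ⁆) ⇔ (σ - x ⊆ τ)
⊆∪⁅x⁆⇔-x⊆ = mk⇔ ⊆∪⁅x⁆⇒-x⊆ -x⊆⇒⊆∪⁅x⁆

⊎-exchange : ∀ {A B C : Set} → (A ⊎ (B ⊎ C)) ⇔ (B ⊎ (A ⊎ C))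
⊎-exchange = mk⇔ exchange exchange
  where
  exchange : ∀ {A B C : Set} → A ⊎ (B ⊎ C) → B ⊎ (A ⊎ C)
  exchange = [ inj₂ ∘ inj₁ , [ inj₁ , inj₂ ∘ inj₂ ]′ ]′

proper-face⇒pred-size : ∀ {Π : Complex n} {ρ τ} → Π ρ → ρ ⊆ τ → ¬ Π τ → suc (∣ τ ∣ ∸ 1) ≡ ∣ τ ∣
proper-face⇒pred-size {Π = Π} {ρ} {τ} Πρ ρ⊆τ τ∉Π with ∣ τ ∣ in ∣τ∣≡
... | suc _ = refl
... | zero = contradiction (subst Π (p⊆q∧∣q∣≤∣p∣⇒p≡q ρ⊆τ (subst (_≤ ∣ ρ ∣) (sym ∣τ∣≡) z≤n)) Πρ) τ∉Π

-- Q is the complex generated by Π₀ and the cones v * τ over earlier facets τ of a shelling with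
-- complex Π; a face of Q below v * τ either lies below τ in Π₀ or is a cone over a face of Π.
module Cone {n} (v : Fin n) {Π₀ : Complex n} (v∉Π₀ : ∀ {σ} → Π₀ σ → v ∉ σ) where

  cone-pure : ∀ {Π Q : Complex n} {τ} → v ∉ τ → Π₀ τ → ¬ Π τ →
    PureOfSize (λ σ → σ ⊆ τ × Π σ) (∣ τ ∣ ∸ 1) → (Q ≋ λ σ → Π₀ σ ⊎ Π (σ - v)) →
    PureOfSize (λ σ → σ ⊆ τ ∪ ⁅ v ⁆ × Q σ) ∣ τ ∣
  cone-pure {Π = Π} {Q} {τ} v∉τ Π₀τ τ∉Π (extend , bound) Q≋ = extend′ , bound′
    where
    extend′ : ∀ σ → σ ⊆ τ ∪ ⁅ v ⁆ × Q σ → ∃ λ ρ → (ρ ⊆ τ ∪ ⁅ v ⁆ × Q ρ) × σ ⊆ ρ × ∣ ρ ∣ ≡ ∣ τ ∣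
    extend′ σ (σ⊆τ∪v , Qσ) with to (Q≋ σ) Qσ
    ... | inj₁ Π₀σ = τ , (p⊆p∪q ⁅ v ⁆ , from (Q≋ τ) (inj₁ Π₀τ)) , ⊆∪⁅x⁆∧x∉⇒⊆ σ⊆τ∪v (v∉Π₀ Π₀σ) , refl
    ... | inj₂ Πσ-v with extend (σ - v) (⊆∪⁅x⁆⇒-x⊆ σ⊆τ∪v , Πσ-v)
    ... | ρ , (ρ⊆τ , Πρ) , σ-v⊆ρ , ∣ρ∣≡ =
      ρ ∪ ⁅ v ⁆ ,
      (p⊆q⇒p∪r⊆q∪r ⁅ v ⁆ ρ⊆τ , from (Q≋ (ρ ∪ ⁅ v ⁆)) (inj₂ (subst Π (sym (p∪⁅x⁆-x≡p v∉ρ)) Πρ))) ,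
      -x⊆⇒⊆∪⁅x⁆ σ-v⊆ρ ,
      trans (∣p∪⁅x⁆∣≡1+∣p∣ v∉ρ) (trans (cong suc ∣ρ∣≡) (proper-face⇒pred-size Πρ ρ⊆τ τ∉Π))
      where
      v∉ρ : v ∉ ρ
      v∉ρ = v∉τ ∘ ρ⊆τ
    bound′ : ∀ ρ → ρ ⊆ τ ∪ ⁅ v ⁆ × Q ρ → ∣ ρ ∣ ≤ ∣ τ ∣
    bound′ ρ (ρ⊆τ∪v , Qρ) with to (Q≋ ρ) Qρ
    ... | inj₁ Π₀ρ = p⊆q⇒∣p∣≤∣q∣ (⊆∪⁅x⁆∧x∉⇒⊆ ρ⊆τ∪v (v∉Π₀ Π₀ρ))
    ... | inj₂ Πρ-v = begin
      ∣ ρ ∣                ≤⟨ ∣p∣≤1+∣p-x∣ ρ v ⟩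
      suc ∣ ρ - v ∣        ≤⟨ s≤s (bound (ρ - v) (ρ-v⊆τ , Πρ-v)) ⟩
      suc (∣ τ ∣ ∸ 1)      ≡⟨ proper-face⇒pred-size Πρ-v ρ-v⊆τ τ∉Π ⟩
      ∣ τ ∣                ∎
      where
      open ≤-Reasoning
      ρ-v⊆τ : ρ - v ⊆ τ
      ρ-v⊆τ = ⊆∪⁅x⁆⇒-x⊆ ρ⊆τ∪v

  ShellingAfter-cone : ∀ {Π Q : Complex n} L → ShellingAfter Π L → Fresh Π L → All (λ τ → v ∉ τ × Π₀ τ) L →
    (Q ≋ λ σ → Π₀ σ ⊎ Π (σ - v)) → ShellingAfter Q (map (_∪ ⁅ v ⁆) L)
  ShellingAfter-cone [] _ _ _ _ = tt
  ShellingAfter-cone {Π = Π} {Q} (τ ∷ L) (pure , shelling) (τ∉Π , fresh) ((v∉τ , Π₀τ) ∷ below) Q≋ =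
    subst (PureOfSize _) (sym (cong (_∸ 1) (∣p∪⁅x⁆∣≡1+∣p∣ v∉τ))) (cone-pure v∉τ Π₀τ τ∉Π pure Q≋) ,
    ShellingAfter-cone L shelling fresh below Q′≋
    where
    Q′≋ : addFacet Q (τ ∪ ⁅ v ⁆) ≋ λ σ → Π₀ σ ⊎ addFacet Π τ (σ - v)
    Q′≋ σ = ⇔.trans (⊆∪⁅x⁆⇔-x⊆ ⊎-⇔ Q≋ σ) ⊎-exchange

module Decomposition {n} {Δ : Complex n} (closed : DownClosed Δ) {s} (maxSize : MaxFaceSize Δ s)
                     (v : Fin n) (delPure : PureOfSize (del Δ v) s) where

  delFacet⇒facet : ∀ {F} → IsFacet (del Δ v) F → IsFacet Δ F
  delFacet⇒facet {F} (delF , maximal) with proj₁ delPure F delF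
  ... | τ , delτ , F⊆τ , ∣τ∣≡s =
    maximumSize⇒facet (proj₂ maxSize) (proj₂ delF) (subst (λ ρ → ∣ ρ ∣ ≡ s) (maximal τ delτ F⊆τ) ∣τ∣≡s)

  lkFacet⇒facet : ∀ {τ} → IsFacet (lk Δ v) τ → IsFacet Δ (τ ∪ ⁅ v ⁆)
  lkFacet⇒facet {τ} ((v∉τ , Δτ∪v) , maximal) = Δτ∪v , λ ρ Δρ τ∪v⊆ρ →
    let v∈ρ = τ∪v⊆ρ (x∈p∪⁅x⁆ τ v)
        ρ≡ρ-v∪v = sym (p-x∪⁅x⁆≡p v∈ρ)
    in trans ρ≡ρ-v∪v (cong (_∪ ⁅ v ⁆)
         (maximal (ρ - v) (x∉p-x ρ v , subst Δ ρ≡ρ-v∪v Δρ) (p⊆q∧x∉p⇒p⊆q-x (τ∪v⊆ρ ∘ p⊆p∪q ⁅ v ⁆) v∉τ)))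

  facet-split : ∀ {F} → IsFacet Δ F → IsFacet (del Δ v) F ⊎ (v ∈ F × IsFacet (lk Δ v) (F - v))
  facet-split {F} (ΔF , maximal) with v ∈? F
  ... | no v∉F = inj₁ ((v∉F , ΔF) , λ τ delτ → maximal τ (proj₂ delτ))
  ... | yes v∈F = inj₂ (v∈F , (x∉p-x F v , subst Δ (sym (p-x∪⁅x⁆≡p v∈F)) ΔF) , λ ρ (v∉ρ , Δρ∪v) F-v⊆ρ →
    trans (sym (p∪⁅x⁆-x≡p v∉ρ)) (cong (_- v) (maximal (ρ ∪ ⁅ v ⁆) Δρ∪v (-x⊆⇒⊆∪⁅x⁆ F-v⊆ρ))))

  lkFacet-below : ∀ {Ld} → (∀ F → IsFacet (del Δ v) F → F ∈ˡ Ld) → ∀ {τ} → IsFacet (lk Δ v) τ → Gen Ld τ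
  lkFacet-below complete ((v∉τ , Δτ∪v) , _) with proj₁ delPure _ (v∉τ , closed (p⊆p∪q ⁅ v ⁆) Δτ∪v)
  ... | ρ , delρ , τ⊆ρ , ∣ρ∣≡s =
    lose (complete ρ (maximumSize⇒facet (λ σ → proj₂ maxSize σ ∘ proj₂) delρ ∣ρ∣≡s)) τ⊆ρ

  shelling : Shellable (lk Δ v) → Shellable (del Δ v) → Shellable Δ
  shelling (Ll , lk-facets , lk-complete , lk-unique , lk-shelling)
           (Ld , del-facets , del-complete , del-unique , del-shelling) =
    Ld ++ M ,
    All.++⁺ (All.map delFacet⇒facet del-facets) (All.map⁺ (All.map lkFacet⇒facet lk-facets)) ,
    complete ,
    Unique.++⁺ del-unique M-unique disjoint ,
    from (ShellCond⇔ShellingAfter [] (Ld ++ M) ⟨[]⟩≋noFaces)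
      (ShellingAfter-++ Ld (to (ShellCond⇔ShellingAfter [] Ld ⟨[]⟩≋noFaces) del-shelling) M-shelling)
    where
    M : List (Subset n)
    M = map (_∪ ⁅ v ⁆) Ll
    Π₀ : Complex n
    Π₀ = foldl addFacet noFaces Ld
    ⟨[]⟩≋noFaces : Gen [] ≋ noFaces
    ⟨[]⟩≋noFaces σ = mk⇔ (λ ()) (λ ())
    complete : ∀ F → IsFacet Δ F → F ∈ˡ Ld ++ M
    complete F F-facet with facet-split F-facet
    ... | inj₁ delFacet = ∈-++⁺ˡ (del-complete F delFacet)
    ... | inj₂ (v∈F , lkFacet) =
      ∈-++⁺ʳ Ld (subst (_∈ˡ M) (p-x∪⁅x⁆≡p v∈F) (∈-map⁺ (_∪ ⁅ v ⁆) (lk-complete (F - v) lkFacet)))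
    M-v≡Ll : map (_- v) M ≡ Ll
    M-v≡Ll = trans (sym (map-∘ Ll))
                   (map-id-local (All.map (λ τ-facet → p∪⁅x⁆-x≡p (proj₁ (proj₁ τ-facet))) lk-facets))
    M-unique : Unique M
    M-unique = Unique.map⁻ (subst Unique (sym M-v≡Ll) lk-unique)
    disjoint : ∀ {F} → ¬ (F ∈ˡ Ld × F ∈ˡ M)
    disjoint (F∈Ld , F∈M) with ∈-map⁻ (_∪ ⁅ v ⁆) F∈M
    ... | τ , _ , refl = proj₁ (proj₁ (All.lookup del-facets F∈Ld)) (x∈p∪⁅x⁆ τ v)
    v∉Π₀ : ∀ {σ} → Π₀ σ → v ∉ σ
    v∉Π₀ {σ} Π₀σ with to (foldl-addFacet Ld σ) Π₀σ
    ... | inj₂ σ∈⟨Ld⟩ with find σ∈⟨Ld⟩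
    ... | F , F∈Ld , σ⊆F = proj₁ (proj₁ (All.lookup del-facets F∈Ld)) ∘ σ⊆F
    M-shelling : ShellingAfter Π₀ M
    M-shelling = Cone.ShellingAfter-cone v v∉Π₀ Ll
      (to (ShellCond⇔ShellingAfter [] Ll ⟨[]⟩≋noFaces) lk-shelling)
      (facets-fresh Ll lk-facets lk-unique (λ ()))
      (All.map (λ τ-facet → proj₁ (proj₁ τ-facet) ,
                            from (foldl-addFacet Ld _) (inj₂ (lkFacet-below del-complete τ-facet))) lk-facets)
      (λ σ → mk⇔ inj₁ [ (λ Π₀σ → Π₀σ) , (λ ()) ]′)

VertexDecomposable⇒Shellable : ∀ {Δ : Complex n} → DownClosed Δ → VertexDecomposable Δ → Shellable Δ
VertexDecomposable⇒Shellable closed (void none) =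
  [] , [] , (λ F F-facet → contradiction (proj₁ F-facet) (none F)) , [] , tt
VertexDecomposable⇒Shellable {Δ = Δ} closed (simplex (F , faces)) =
  F ∷ [] , F-facet ∷ [] ,
  (λ G G-facet → here (sym (proj₂ G-facet F (proj₁ F-facet) (to (faces G) (proj₁ G-facet))))) , [] ∷ [] , tt
  where
  F-facet : IsFacet Δ F
  F-facet = from (faces F) (λ x∈F → x∈F) , λ τ Δτ F⊆τ → ⊆-antisym (to (faces τ) Δτ) F⊆τ
VertexDecomposable⇒Shellable closed (decomp s maxSize v _ lkVD delVD delPure) =
  Decomposition.shelling closed maxSize v delPure
    (VertexDecomposable⇒Shellable (lk-closed v closed) lkVD)
    (VertexDecomposable⇒Shellable (del-closed v closed) delVD)

n≢0∧n≢1⇒2≤n : ∀ {n} → n ≢ 0 → n ≢ 1 → 2 ≤ n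
n≢0∧n≢1⇒2≤n {zero} n≢0 _ = contradiction refl n≢0
n≢0∧n≢1⇒2≤n {suc zero} _ n≢1 = contradiction refl n≢1
n≢0∧n≢1⇒2≤n {suc (suc n)} _ _ = s≤s (s≤s z≤n)

extendAfter : ∀ {A : Set} → (ℕ → A) → ℕ → A → ℕ → A
extendAfter f j x i with i ≤? j
... | yes _ = f i
... | no _ = x

extendAfter-≤ : ∀ {A : Set} {f : ℕ → A} {j x i} → i ≤ j → extendAfter f j x i ≡ f i
extendAfter-≤ {j = j} {i = i} i≤j with i ≤? j
... | yes _ = refl
... | no i≰j = contradiction i≤j i≰j

extendAfter-> : ∀ {A : Set} {f : ℕ → A} {j x i} → j < i → extendAfter f j x i ≡ x
extendAfter-> {j = j} {i = i} j<i with i ≤? j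
... | yes i≤j = contradiction i≤j (<⇒≱ j<i)
... | no _ = refl

module _ {n} (G : Graph n) where

  nbhd : Fin n → Subset n
  nbhd v = tabulate (adj G v)

  closedNbhd : Fin n → Subset n
  closedNbhd v = nbhd v ∪ ⁅ v ⁆

  Edge? : ∀ x y → Dec (Edge G x y)
  Edge? x y = adj G x y Data.Bool.≟ true

  Edge-sym : ∀ {x y} → Edge G x y → Edge G y x
  Edge-sym {x} {y} x~y = trans (Graph.sym G y x) x~y

  Simplicial : Subset n → Fin n → Set
  Simplicial W v = ∀ {y z} → y ∈ W → z ∈ W → Edge G v y → Edge G v z → y ≢ z → Edge G y z

  HasSimplicialVertices : Set
  HasSimplicialVertices = ∀ W → Nonempty W → ∃ λ v → v ∈ W × Simplicial W v

  Independent? : ∀ S → Dec (Independent G S)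
  Independent? S = all? λ i → all? λ j → i ∈? S →-dec j ∈? S →-dec ¬? (Edge? i j)

  Independent-⊆ : ∀ {S T} → T ⊆ S → Independent G S → Independent G T
  Independent-⊆ T⊆S independent i j i∈T j∈T = independent i j (T⊆S i∈T) (T⊆S j∈T)

  Independent-∪⁅x⁆ : ∀ {S x} → Independent G S → (∀ {y} → y ∈ S → ¬ Edge G x y) → Independent G (S ∪ ⁅ x ⁆)
  Independent-∪⁅x⁆ {S} {x} independent x≁S i j i∈ j∈ with x∈p∪⁅y⁆⁻ S x i∈ | x∈p∪⁅y⁆⁻ S x j∈
  ... | inj₁ i∈S | inj₁ j∈S = independent i j i∈S j∈S
  ... | inj₁ i∈S | inj₂ refl = x≁S i∈S ∘ Edge-sym
  ... | inj₂ refl | inj₁ j∈S = x≁S j∈S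
  ... | inj₂ refl | inj₂ refl = irrefl G x

  RestrictedCut : Subset n → Subset n → ℕ → Complex n
  RestrictedCut V W k τ = τ ⊆ V × Σ (Subset n) λ S → Independent G S × ∣ S ∣ ≡ k × S ⊆ W × S ⊆ ∁ τ

  RestrictedCut-closed : ∀ {V W k} → DownClosed (RestrictedCut V W k)
  RestrictedCut-closed σ⊆τ (τ⊆V , S , independent , ∣S∣≡k , S⊆W , S⊆∁τ) =
    τ⊆V ∘ σ⊆τ , S , independent , ∣S∣≡k , S⊆W , p⊆q⇒∁p⊇∁q σ⊆τ ∘ S⊆∁τ

  RestrictedCut-pure : ∀ {V W k} → W ⊆ V → PureOfSize (RestrictedCut V W k) (∣ V ∣ ∸ k)
  RestrictedCut-pure {V} {W} {k} W⊆V = extend , bound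
    where
    ∣V─S∣ : ∀ {S} → S ⊆ W → ∣ S ∣ ≡ k → ∣ V ─ S ∣ ≡ ∣ V ∣ ∸ k
    ∣V─S∣ S⊆W refl = ∣p─q∣≡∣p∣∸∣q∣ (W⊆V ∘ S⊆W)
    ⊆V─S : ∀ {τ S} → τ ⊆ V → S ⊆ ∁ τ → τ ⊆ V ─ S
    ⊆V─S τ⊆V S⊆∁τ x∈τ = x∈p∧x∉q⇒x∈p─q (τ⊆V x∈τ) (λ x∈S → x∈∁p⇒x∉p (S⊆∁τ x∈S) x∈τ)
    extend : ∀ σ → RestrictedCut V W k σ → ∃ λ τ → RestrictedCut V W k τ × σ ⊆ τ × ∣ τ ∣ ≡ ∣ V ∣ ∸ k
    extend σ (σ⊆V , S , independent , ∣S∣≡k , S⊆W , S⊆∁σ) =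
      V ─ S , (p─q⊆p V S , S , independent , ∣S∣≡k , S⊆W , λ x∈S → x∉p⇒x∈∁p (λ x∈V─S → x∈p─q⇒x∉q x∈V─S x∈S)) ,
      ⊆V─S σ⊆V S⊆∁σ , ∣V─S∣ S⊆W ∣S∣≡k
    bound : ∀ τ → RestrictedCut V W k τ → ∣ τ ∣ ≤ ∣ V ∣ ∸ k
    bound τ (τ⊆V , S , _ , ∣S∣≡k , S⊆W , S⊆∁τ) =
      subst (∣ τ ∣ ≤_) (∣V─S∣ S⊆W ∣S∣≡k) (p⊆q⇒∣p∣≤∣q∣ (⊆V─S τ⊆V S⊆∁τ))

  lk-RestrictedCut : ∀ {V W k v} → v ∈ V → lk (RestrictedCut V W k) v ≋ RestrictedCut (V - v) (W - v) k
  lk-RestrictedCut {V} {W} {k} {v} v∈V σ = mk⇔ to′ from′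
    where
    to′ : lk (RestrictedCut V W k) v σ → RestrictedCut (V - v) (W - v) k σ
    to′ (v∉σ , σ∪v⊆V , S , independent , ∣S∣≡k , S⊆W , S⊆∁σ∪v) =
      p⊆q∧x∉p⇒p⊆q-x (σ∪v⊆V ∘ p⊆p∪q ⁅ v ⁆) v∉σ , S , independent , ∣S∣≡k ,
      p⊆q∧x∉p⇒p⊆q-x S⊆W (λ v∈S → x∈∁p⇒x∉p (S⊆∁σ∪v v∈S) (x∈p∪⁅x⁆ σ v)) ,
      p⊆q⇒∁p⊇∁q (p⊆p∪q ⁅ v ⁆) ∘ S⊆∁σ∪v
    from′ : RestrictedCut (V - v) (W - v) k σ → lk (RestrictedCut V W k) v σ
    from′ (σ⊆V-v , S , independent , ∣S∣≡k , S⊆W-v , S⊆∁σ) =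
      x∉p-x V v ∘ σ⊆V-v ,
      [ proj₁ ∘ x∈p-y⁻ ∘ σ⊆V-v , (λ { refl → v∈V }) ]′ ∘ x∈p∪⁅y⁆⁻ σ v ,
      S , independent , ∣S∣≡k , proj₁ ∘ x∈p-y⁻ ∘ S⊆W-v ,
      λ x∈S → x∉p⇒x∈∁p ([ x∈∁p⇒x∉p (S⊆∁σ x∈S) , (λ { refl → x∉p-x W v (S⊆W-v x∈S) }) ]′ ∘ x∈p∪⁅y⁆⁻ σ v)

  independent-∩closedNbhd : ∀ {W S v} → Simplicial W v → Independent G S → S ⊆ W → ∣ S ∩ closedNbhd v ∣ ≤ 1
  independent-∩closedNbhd {W} {S} {v} simplicial independent S⊆W = ∣p∣≤1 (S ∩ closedNbhd v) unique
    where
    unique : ∀ {x y} → x ∈ S ∩ closedNbhd v → y ∈ S ∩ closedNbhd v → x ≡ y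
    unique {x} {y} x∈ y∈ with x∈p∩q⁻ S _ x∈ | x∈p∩q⁻ S _ y∈
    ... | x∈S , x∈N | y∈S , y∈N with x∈p∪⁅y⁆⁻ (nbhd v) v x∈N | x∈p∪⁅y⁆⁻ (nbhd v) v y∈N
    ... | inj₂ refl | inj₂ refl = refl
    ... | inj₂ refl | inj₁ v~y = contradiction (to x∈tabulate⇔ v~y) (independent x y x∈S y∈S)
    ... | inj₁ v~x | inj₂ refl = contradiction (Edge-sym (to x∈tabulate⇔ v~x)) (independent x y x∈S y∈S)
    ... | inj₁ v~x | inj₁ v~y with x Data.Fin.≟ y
    ...   | yes x≡y = x≡y
    ...   | no x≢y =
      contradiction (simplicial (S⊆W x∈S) (S⊆W y∈S) (to x∈tabulate⇔ v~x) (to x∈tabulate⇔ v~y) x≢y)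
                    (independent x y x∈S y∈S)

  del-RestrictedCut : ∀ {V W k v} → v ∈ W → Simplicial W v →
    del (RestrictedCut V W (suc k)) v ≋ RestrictedCut (V - v) (W ─ closedNbhd v) k
  del-RestrictedCut {V} {W} {k} {v} v∈W simplicial σ = mk⇔ to′ from′
    where
    N : Subset n
    N = closedNbhd v
    to′ : del (RestrictedCut V W (suc k)) v σ → RestrictedCut (V - v) (W ─ N) k σ
    to′ (v∉σ , σ⊆V , S , independent , ∣S∣≡1+k , S⊆W , S⊆∁σ) with ⊆-ofSize (S ─ N) k k≤∣S─N∣
      where
      k≤∣S─N∣ : k ≤ ∣ S ─ N ∣
      k≤∣S─N∣ = ≤-pred (begin
        suc k                  ≡⟨ sym ∣S∣≡1+k ⟩
        ∣ S ∣                  ≡⟨ ∣p∣≡∣p∩q∣+∣p─q∣ S N ⟩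
        ∣ S ∩ N ∣ + ∣ S ─ N ∣  ≤⟨ +-monoˡ-≤ ∣ S ─ N ∣ (independent-∩closedNbhd simplicial independent S⊆W) ⟩
        suc ∣ S ─ N ∣          ∎)
        where open ≤-Reasoning
    ... | S′ , S′⊆S─N , ∣S′∣≡k =
      p⊆q∧x∉p⇒p⊆q-x σ⊆V v∉σ , S′ , Independent-⊆ (p─q⊆p S N ∘ S′⊆S─N) independent , ∣S′∣≡k ,
      p⊆r∧s⊆q⇒p─q⊆r─s S⊆W (λ x∈N → x∈N) ∘ S′⊆S─N , S⊆∁σ ∘ p─q⊆p S N ∘ S′⊆S─N
    from′ : RestrictedCut (V - v) (W ─ N) k σ → del (RestrictedCut V W (suc k)) v σ
    from′ (σ⊆V-v , S′ , independent , ∣S′∣≡k , S′⊆W─N , S′⊆∁σ) =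
      v∉σ , proj₁ ∘ x∈p-y⁻ ∘ σ⊆V-v , S′ ∪ ⁅ v ⁆ ,
      Independent-∪⁅x⁆ independent (λ y∈S′ v~y → S′∌N y∈S′ (p⊆p∪q ⁅ v ⁆ (from x∈tabulate⇔ v~y))) ,
      trans (∣p∪⁅x⁆∣≡1+∣p∣ (λ v∈S′ → S′∌N v∈S′ (x∈p∪⁅x⁆ (nbhd v) v))) (cong suc ∣S′∣≡k) ,
      [ p─q⊆p W N ∘ S′⊆W─N , (λ { refl → v∈W }) ]′ ∘ x∈p∪⁅y⁆⁻ S′ v ,
      [ S′⊆∁σ , (λ { refl → x∉p⇒x∈∁p v∉σ }) ]′ ∘ x∈p∪⁅y⁆⁻ S′ v
      where
      v∉σ : v ∉ σ
      v∉σ = x∉p-x V v ∘ σ⊆V-v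
      S′∌N : ∀ {y} → y ∈ S′ → y ∉ N
      S′∌N y∈S′ = x∈p─q⇒x∉q (S′⊆W─N y∈S′)

  singleton-face? : ∀ {V W k v} → v ∈ V → Dec (RestrictedCut V W k ⁅ v ⁆)
  singleton-face? {V} {W} {k} {v} v∈V
    with anySubset? (λ S → Independent? S ×-dec ∣ S ∣ ≟ k ×-dec S ⊆? W ×-dec S ⊆? ∁ ⁅ v ⁆)
  ... | yes (S , independent , ∣S∣≡k , S⊆W , S⊆∁v) =
    yes ((λ x∈⁅v⁆ → subst (_∈ V) (sym (x∈⁅y⁆⇒x≡y v x∈⁅v⁆)) v∈V) , S , independent , ∣S∣≡k , S⊆W , S⊆∁v)
  ... | no none =
    no (λ (_ , S , independent , ∣S∣≡k , S⊆W , S⊆∁v) → none (S , independent , ∣S∣≡k , S⊆W , S⊆∁v))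

  RestrictedCut-void : ∀ {V W m} → ∣ W ∣ < m → Void (RestrictedCut V W m)
  RestrictedCut-void {W = W} ∣W∣<m σ (_ , S , _ , refl , S⊆W , _) = <⇒≱ ∣W∣<m (p⊆q⇒∣p∣≤∣q∣ S⊆W)

  RestrictedCut-decompose : ∀ {V W k v} → W ⊆ V → v ∈ W → Simplicial W v →
    VertexDecomposable (RestrictedCut (V - v) (W - v) (suc k)) →
    VertexDecomposable (RestrictedCut (V - v) (W ─ closedNbhd v) k) →
    VertexDecomposable (RestrictedCut V W (suc k))
  RestrictedCut-decompose {V} {W} {k} {v} W⊆V v∈W simplicial lkVD delVD with singleton-face? (W⊆V v∈W)
  ... | yes face = decomp (∣ V ∣ ∸ suc k) (PureOfSize⇒MaxFaceSize (RestrictedCut-pure W⊆V) face) v face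
    (VertexDecomposable-resp (≋-sym (lk-RestrictedCut (W⊆V v∈W))) lkVD)
    (VertexDecomposable-resp (≋-sym del≋) delVD)
    (PureOfSize-resp (≋-sym del≋) (subst (PureOfSize _) ∣V-v∣∸k≡ (RestrictedCut-pure W─N⊆V-v)))
    where
    del≋ : del (RestrictedCut V W (suc k)) v ≋ RestrictedCut (V - v) (W ─ closedNbhd v) k
    del≋ = del-RestrictedCut v∈W simplicial
    ∣V-v∣∸k≡ : ∣ V - v ∣ ∸ k ≡ ∣ V ∣ ∸ suc k
    ∣V-v∣∸k≡ = sym (cong (_∸ suc k) (∣p∣≡1+∣p-x∣ (W⊆V v∈W)))
    W─N⊆V-v : W ─ closedNbhd v ⊆ V - v
    W─N⊆V-v = p⊆r∧s⊆q⇒p─q⊆r─s W⊆V (q⊆p∪q (nbhd v) ⁅ v ⁆)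
  ... | no nonface = VertexDecomposable-resp
    (≋-sym (≋-trans (nonvertex⇒≋del RestrictedCut-closed nonface) (del-RestrictedCut v∈W simplicial))) delVD

  RestrictedCut-vertexDecomposable : HasSimplicialVertices → ∀ b {V W} k → ∣ W ∣ ≤ b → W ⊆ V →
    VertexDecomposable (RestrictedCut V W k)
  RestrictedCut-vertexDecomposable _ _ {V} {W} zero _ _ = simplex (V , λ σ → mk⇔ proj₁ (face σ))
    where
    face : ∀ σ → σ ⊆ V → RestrictedCut V W zero σ
    face σ σ⊆V = σ⊆V , ⊥ , (λ i _ i∈⊥ → contradiction i∈⊥ ∉⊥) , ∣⊥∣≡0 n , ⊆-min W , ⊆-min (∁ σ)
  RestrictedCut-vertexDecomposable _ zero (suc k) ∣W∣≤0 _ = void (RestrictedCut-void (s≤s (≤-trans ∣W∣≤0 z≤n)))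
  RestrictedCut-vertexDecomposable simplicialVertices (suc b) {V} {W} (suc k) ∣W∣≤1+b W⊆V with nonempty? W
  ... | no empty = void (RestrictedCut-void (s≤s (≤-trans (≤-reflexive ∣W∣≡0) z≤n)))
    where
    ∣W∣≡0 : ∣ W ∣ ≡ 0
    ∣W∣≡0 = trans (cong ∣_∣ (Empty-unique empty)) (∣⊥∣≡0 n)
  ... | yes nonempty with simplicialVertices W nonempty
  ...   | v , v∈W , simplicial = RestrictedCut-decompose W⊆V v∈W simplicial
    (RestrictedCut-vertexDecomposable simplicialVertices b (suc k) ∣W-v∣≤b W-v⊆V-v)
    (RestrictedCut-vertexDecomposable simplicialVertices b k (≤-trans (p⊆q⇒∣p∣≤∣q∣ W─N⊆W-v) ∣W-v∣≤b)
                                                             (W-v⊆V-v ∘ W─N⊆W-v))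
    where
    ∣W-v∣≤b : ∣ W - v ∣ ≤ b
    ∣W-v∣≤b = ≤-pred (≤-trans (x∈p⇒∣p-x∣<∣p∣ v∈W) ∣W∣≤1+b)
    W-v⊆V-v : W - v ⊆ V - v
    W-v⊆V-v = p⊆r∧s⊆q⇒p─q⊆r─s W⊆V (λ x∈⁅v⁆ → x∈⁅v⁆)
    W─N⊆W-v : W ─ closedNbhd v ⊆ W - v
    W─N⊆W-v = p⊆r∧s⊆q⇒p─q⊆r─s (λ x∈W → x∈W) (q⊆p∪q (nbhd v) ⁅ v ⁆)

  record ChordlessPath (j : ℕ) (p : ℕ → Fin n) : Set where
    field
      injective : ∀ {i i′} → i ≤ j → i′ ≤ j → p i ≡ p i′ → i ≡ i′
      step : ∀ {i} → i < j → Edge G (p i) (p (suc i))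
      chordless : ∀ {i i′} → i ≤ j → i′ ≤ j → Edge G (p i) (p i′) → i′ ≤ suc i

  module Layers (Y : Subset n) {a : Fin n} (a∈Y : a ∈ Y) where

    joins? : ∀ R x → Dec (x ∈ Y × ∃ λ z → z ∈ R × Edge G z x)
    joins? R x = x ∈? Y ×-dec any? (λ z → z ∈? R ×-dec Edge? z x)

    grow : Subset n → Subset n
    grow R = R ∪ toSubset (joins? R)

    ∈grow⁺ : ∀ {R z x} → z ∈ R → x ∈ Y → Edge G z x → x ∈ grow R
    ∈grow⁺ {R} z∈R x∈Y z~x = q⊆p∪q R _ (from (x∈toSubset⇔ (joins? R)) (x∈Y , _ , z∈R , z~x))

    ∈grow⁻ : ∀ {R x} → x ∈ grow R → x ∈ R ⊎ (x ∈ Y × ∃ λ z → z ∈ R × Edge G z x)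
    ∈grow⁻ {R} x∈ = Data.Sum.map₂ (to (x∈toSubset⇔ (joins? R))) (x∈p∪q⁻ R _ x∈)

    grow-mono : ∀ {R R′} → R ⊆ R′ → grow R ⊆ grow R′
    grow-mono R⊆R′ x∈ with ∈grow⁻ x∈
    ... | inj₁ x∈R = p⊆p∪q _ (R⊆R′ x∈R)
    ... | inj₂ (x∈Y , z , z∈R , z~x) = ∈grow⁺ (R⊆R′ z∈R) x∈Y z~x

    layer : ℕ → Subset n
    layer zero = ⁅ a ⁆
    layer (suc k) = grow (layer k)

    closure : Subset n
    closure = layer n

    layer-mono : ∀ {k k′} → k ≤ k′ → layer k ⊆ layer k′
    layer-mono = mono ∘ ≤⇒≤′
      where
      mono : ∀ {k k′} → k ≤′ k′ → layer k ⊆ layer k′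
      mono ≤′-refl = λ x∈ → x∈
      mono (≤′-step k≤′k′) = p⊆p∪q _ ∘ mono k≤′k′

    layer⊆Y : ∀ k → layer k ⊆ Y
    layer⊆Y zero x∈ = subst (_∈ Y) (sym (x∈⁅y⁆⇒x≡y a x∈)) a∈Y
    layer⊆Y (suc k) x∈ = [ layer⊆Y k , proj₁ ]′ (∈grow⁻ x∈)

    stable-or-large : ∀ k → layer (suc k) ≡ layer k ⊎ suc k ≤ ∣ layer k ∣
    stable-or-large zero = inj₂ (≤-reflexive (sym (∣⁅x⁆∣≡1 a)))
    stable-or-large (suc k) with stable-or-large k
    ... | inj₁ stable = inj₁ (cong grow stable)
    ... | inj₂ large with ∣ layer (suc k) ∣ ≤? ∣ layer k ∣
    ...   | yes small = inj₁ (cong grow (sym (p⊆q∧∣q∣≤∣p∣⇒p≡q (p⊆p∪q _) small)))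
    ...   | no ¬small = inj₂ (≤-trans (s≤s large) (≰⇒> ¬small))

    grow-closure : grow closure ≡ closure
    grow-closure with stable-or-large n
    ... | inj₁ stable = stable
    ... | inj₂ large = contradiction (∣p∣≤n (layer n)) (<⇒≱ large)

    layer⊆closure : ∀ k → layer k ⊆ closure
    layer⊆closure zero = layer-mono {k′ = n} z≤n
    layer⊆closure (suc k) = subst (layer (suc k) ⊆_) grow-closure (grow-mono (layer⊆closure k))

    closure-closed : ∀ {x y} → x ∈ closure → y ∈ Y → Edge G x y → y ∈ closure
    closure-closed x∈ y∈Y x~y = subst (_ ∈_) grow-closure (∈grow⁺ x∈ y∈Y x~y)

    AtDistance : ℕ → Fin n → Set
    AtDistance j x = x ∈ layer j × ∀ {i} → i < j → x ∉ layer i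

    distance : ∀ {j x} → x ∈ layer j → ∃ λ i → AtDistance i x
    distance {zero} x∈ = 0 , x∈ , λ ()
    distance {suc j} {x} x∈ with x ∈? layer j
    ... | yes x∈layer-j = distance {j} x∈layer-j
    ... | no x∉layer-j = suc j , x∈ , λ i<1+j → x∉layer-j ∘ layer-mono (≤-pred i<1+j)

    distance-unique : ∀ {i j x} → AtDistance i x → AtDistance j x → i ≡ j
    distance-unique {i} {j} (x∈i , below-i) (x∈j , below-j) with <-cmp i j
    ... | tri< i<j _ _ = contradiction x∈i (below-j i<j)
    ... | tri≈ _ i≡j _ = i≡j
    ... | tri> _ _ j<i = contradiction x∈j (below-i j<i)

    neighbour-distance : ∀ {i j x y} → AtDistance i x → AtDistance j y → Edge G x y → j ≤ suc i
    neighbour-distance {i} {j} {y = y} (x∈i , _) (y∈j , below-j) x~y with j ≤? suc i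
    ... | yes j≤1+i = j≤1+i
    ... | no j≰1+i = contradiction (∈grow⁺ x∈i (layer⊆Y j y∈j) x~y) (below-j (≰⇒> j≰1+i))

    predecessor : ∀ {i x} → AtDistance (suc i) x → ∃ λ z → AtDistance i z × Edge G z x
    predecessor {i} (x∈ , below) with ∈grow⁻ x∈
    ... | inj₁ x∈i = contradiction x∈i (below (n<1+n i))
    ... | inj₂ (x∈Y , z , z∈i , z~x) =
      z , (z∈i , λ i′<i z∈i′ → below (s≤s i′<i) (∈grow⁺ z∈i′ x∈Y z~x)) , z~x

    connected : ∀ (P : Fin n → Set) → (∀ {x y} → x ∈ closure → y ∈ closure → Edge G x y → P x → P y) →
      ∀ {x} → x ∈ closure → P x → ∀ {y} → y ∈ closure → P y
    connected P spreads x∈ Px = spread n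
      where
      toRoot : ∀ {d x} → AtDistance d x → P x → P a
      toRoot {zero} (x∈⁅a⁆ , _) Px = subst P (x∈⁅y⁆⇒x≡y a x∈⁅a⁆) Px
      toRoot {suc d} x-at Px with predecessor x-at
      ... | z , z-at , z~x =
        toRoot z-at (spreads (layer⊆closure (suc d) (proj₁ x-at)) (layer⊆closure d (proj₁ z-at))
                             (Edge-sym z~x) Px)
      spread : ∀ k {y} → y ∈ layer k → P y
      spread zero y∈ = subst P (sym (x∈⁅y⁆⇒x≡y a y∈)) (toRoot (proj₂ (distance {n} x∈)) Px)
      spread (suc k) y∈ with ∈grow⁻ y∈
      ... | inj₁ y∈k = spread k y∈k
      ... | inj₂ (_ , z , z∈k , z~y) =
        spreads (layer⊆closure k z∈k) (layer⊆closure (suc k) y∈) z~y (spread k z∈k)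

    record PathTo (j : ℕ) (x : Fin n) : Set where
      field
        vertex : ℕ → Fin n
        vertex-end : vertex j ≡ x
        vertex-distance : ∀ {i} → i ≤ j → AtDistance i (vertex i)
        vertex-step : ∀ {i} → i < j → Edge G (vertex i) (vertex (suc i))

    pathTo : ∀ {j x} → AtDistance j x → PathTo j x
    pathTo {zero} {x} x-at =
      record { vertex = λ _ → x ; vertex-end = refl ; vertex-distance = λ { z≤n → x-at } ; vertex-step = λ () }
    pathTo {suc j} {x} x-at with predecessor x-at
    ... | z , z-at , z~x = record
      { vertex = extendAfter vertex j x
      ; vertex-end = extendAfter-> (n<1+n j)
      ; vertex-distance = distance′
      ; vertex-step = step′
      }
      where
      open PathTo (pathTo z-at)
      distance′ : ∀ {i} → i ≤ suc j → AtDistance i (extendAfter vertex j x i)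
      distance′ i≤1+j with m≤n⇒m<n∨m≡n i≤1+j
      ... | inj₁ i<1+j =
        subst (AtDistance _) (sym (extendAfter-≤ (≤-pred i<1+j))) (vertex-distance (≤-pred i<1+j))
      ... | inj₂ refl = subst (AtDistance _) (sym (extendAfter-> (n<1+n j))) x-at
      step′ : ∀ {i} → i < suc j → Edge G (extendAfter vertex j x i) (extendAfter vertex j x (suc i))
      step′ i<1+j with m≤n⇒m<n∨m≡n (≤-pred i<1+j)
      ... | inj₁ i<j =
        subst₂ (Edge G) (sym (extendAfter-≤ (<⇒≤ i<j))) (sym (extendAfter-≤ i<j)) (vertex-step i<j)
      ... | inj₂ refl =
        subst₂ (Edge G) (sym (trans (extendAfter-≤ {f = vertex} {j = j} ≤-refl) vertex-end))
                        (sym (extendAfter-> (n<1+n j))) z~x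

    shortestPath : ∀ {x} → x ∈ closure →
      ∃ λ j → ∃ λ p → ChordlessPath j p × p 0 ≡ a × p j ≡ x × ∀ {i} → i ≤ j → p i ∈ Y
    shortestPath x∈ with distance {n} x∈
    ... | j , x-at = j , vertex , chordless′ , x∈⁅y⁆⇒x≡y a (proj₁ (vertex-distance z≤n)) , vertex-end ,
                     λ {i} i≤j → layer⊆Y i (proj₁ (vertex-distance i≤j))
      where
      open PathTo (pathTo x-at)
      chordless′ : ChordlessPath j vertex
      chordless′ = record
        { injective = λ {i} {i′} i≤j i′≤j vᵢ≡vᵢ′ →
            distance-unique (vertex-distance i≤j) (subst (AtDistance i′) (sym vᵢ≡vᵢ′) (vertex-distance i′≤j))
        ; step = vertex-step
        ; chordless = λ i≤j i′≤j e → neighbour-distance (vertex-distance i≤j) (vertex-distance i′≤j) e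
        }

  adjacent-indices : ∀ {i i′} → i′ ≤ suc i → i ≤ suc i′ → i ≢ i′ → suc i ≡ i′ ⊎ suc i′ ≡ i
  adjacent-indices {i} {i′} i′≤1+i i≤1+i′ i≢i′ with <-cmp i i′
  ... | tri< i<i′ _ _ = inj₁ (≤-antisym i<i′ i′≤1+i)
  ... | tri≈ _ i≡i′ _ = contradiction i≡i′ i≢i′
  ... | tri> _ _ i′<i = inj₂ (≤-antisym i′<i i≤1+i′)

  chordlessPath+apex⇒InducedCycle : ∀ {j p u} → ChordlessPath j p → (∀ {i} → i ≤ j → p i ≢ u) →
    Edge G u (p 0) → Edge G u (p j) → (∀ {i} → 0 < i → i < j → ¬ Edge G u (p i)) →
    InducedCycle G (suc (suc j)) (extendAfter p j u ∘ toℕ)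
  chordlessPath+apex⇒InducedCycle {j} {p} {u} path p≢u u~p₀ u~pⱼ u≁interior =
    injective′ , λ a b → mk⇔ (edge⇒adjacent a b) (adjacent⇒edge a b)
    where
    open ChordlessPath path
    c : Fin (suc (suc j)) → Fin n
    c = extendAfter p j u ∘ toℕ
    position : ∀ a → (toℕ a ≤ j × c a ≡ p (toℕ a)) ⊎ (toℕ a ≡ suc j × c a ≡ u)
    position a with m≤n⇒m<n∨m≡n (≤-pred (toℕ<n a))
    ... | inj₁ a<1+j = inj₁ (≤-pred a<1+j , extendAfter-≤ (≤-pred a<1+j))
    ... | inj₂ a≡1+j = inj₂ (a≡1+j , extendAfter-> (≤-reflexive (sym a≡1+j)))
    injective′ : ∀ {a b} → c a ≡ c b → a ≡ b
    injective′ {a} {b} ca≡cb with position a | position b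
    ... | inj₁ (a≤j , ca≡) | inj₁ (b≤j , cb≡) =
      toℕ-injective (injective a≤j b≤j (trans (sym ca≡) (trans ca≡cb cb≡)))
    ... | inj₁ (a≤j , ca≡) | inj₂ (_ , cb≡) = contradiction (trans (sym ca≡) (trans ca≡cb cb≡)) (p≢u a≤j)
    ... | inj₂ (_ , ca≡) | inj₁ (b≤j , cb≡) = contradiction (trans (sym cb≡) (trans (sym ca≡cb) ca≡)) (p≢u b≤j)
    ... | inj₂ (a≡ , _) | inj₂ (b≡ , _) = toℕ-injective (trans a≡ (sym b≡))
    apex-end : ∀ {i} → i ≤ j → Edge G u (p i) → i ≡ 0 ⊎ i ≡ j
    apex-end {zero} _ _ = inj₁ refl
    apex-end {suc i} i≤j u~pᵢ with m≤n⇒m<n∨m≡n i≤j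
    ... | inj₁ i<j = contradiction u~pᵢ (u≁interior (s≤s z≤n) i<j)
    ... | inj₂ i≡j = inj₂ i≡j
    edge⇒adjacent : ∀ a b → Edge G (c a) (c b) → CycAdj (suc (suc j)) a b
    edge⇒adjacent a b ca~cb with position a | position b
    ... | inj₁ (a≤j , ca≡) | inj₁ (b≤j , cb≡) =
      Data.Sum.map₂ inj₁ (adjacent-indices (chordless a≤j b≤j pa~pb) (chordless b≤j a≤j (Edge-sym pa~pb))
        (λ a≡b → irrefl G _ (subst (λ i → Edge G (p (toℕ a)) (p i)) (sym a≡b) pa~pb)))
      where
      pa~pb : Edge G (p (toℕ a)) (p (toℕ b))
      pa~pb = subst₂ (Edge G) ca≡ cb≡ ca~cb
    ... | inj₁ (a≤j , ca≡) | inj₂ (b≡1+j , cb≡) with apex-end a≤j (Edge-sym (subst₂ (Edge G) ca≡ cb≡ ca~cb))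
    ...   | inj₁ a≡0 = inj₂ (inj₂ (inj₁ (a≡0 , cong suc b≡1+j)))
    ...   | inj₂ a≡j = inj₁ (trans (cong suc a≡j) (sym b≡1+j))
    edge⇒adjacent a b ca~cb | inj₂ (a≡1+j , ca≡) | inj₁ (b≤j , cb≡)
      with apex-end b≤j (subst₂ (Edge G) ca≡ cb≡ ca~cb)
    ...   | inj₁ b≡0 = inj₂ (inj₂ (inj₂ (b≡0 , cong suc a≡1+j)))
    ...   | inj₂ b≡j = inj₂ (inj₁ (trans (cong suc b≡j) (sym a≡1+j)))
    edge⇒adjacent a b ca~cb | inj₂ (_ , ca≡) | inj₂ (_ , cb≡) =
      contradiction (subst₂ (Edge G) ca≡ cb≡ ca~cb) (irrefl G u)
    forward : ∀ a b → suc (toℕ a) ≡ toℕ b → Edge G (c a) (c b)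
    forward a b 1+a≡b with position a | position b
    ... | inj₁ (_ , ca≡) | inj₁ (b≤j , cb≡) =
      subst₂ (Edge G) (sym ca≡) (sym (trans cb≡ (cong p (sym 1+a≡b)))) (step (≤-trans (≤-reflexive 1+a≡b) b≤j))
    ... | inj₁ (_ , ca≡) | inj₂ (b≡1+j , cb≡) =
      subst₂ (Edge G) (sym (trans ca≡ (cong p (suc-injective (trans 1+a≡b b≡1+j))))) (sym cb≡) (Edge-sym u~pⱼ)
    ... | inj₂ (a≡1+j , _) | inj₁ (b≤j , _) =
      contradiction (≤-trans (n≤1+n _) (≤-trans (≤-reflexive (trans (cong suc (sym a≡1+j)) 1+a≡b)) b≤j)) 1+n≰n
    ... | inj₂ (a≡1+j , _) | inj₂ (b≡1+j , _) = contradiction (trans 1+a≡b (trans b≡1+j (sym a≡1+j))) (1+n≢n)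
    start : ∀ a → toℕ a ≡ 0 → c a ≡ p 0
    start a a≡0 = trans (extendAfter-≤ (≤-trans (≤-reflexive a≡0) z≤n)) (cong p a≡0)
    apex : ∀ a → toℕ a ≡ suc j → c a ≡ u
    apex a a≡1+j = extendAfter-> (≤-reflexive (sym a≡1+j))
    adjacent⇒edge : ∀ a b → CycAdj (suc (suc j)) a b → Edge G (c a) (c b)
    adjacent⇒edge a b (inj₁ 1+a≡b) = forward a b 1+a≡b
    adjacent⇒edge a b (inj₂ (inj₁ 1+b≡a)) = Edge-sym (forward b a 1+b≡a)
    adjacent⇒edge a b (inj₂ (inj₂ (inj₁ (a≡0 , 1+b≡2+j)))) =
      Edge-sym (subst₂ (Edge G) (sym (apex b (suc-injective 1+b≡2+j))) (sym (start a a≡0)) u~p₀)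
    adjacent⇒edge a b (inj₂ (inj₂ (inj₂ (b≡0 , 1+a≡2+j)))) =
      subst₂ (Edge G) (sym (apex a (suc-injective 1+a≡2+j))) (sym (start b b≡0)) u~p₀

  NonUniversal : Subset n → Fin n → Set
  NonUniversal W u = ∃ λ y → y ∈ W × y ≢ u × ¬ Edge G u y

  NonUniversal? : ∀ W u → Dec (NonUniversal W u)
  NonUniversal? W u = any? λ y → y ∈? W ×-dec ¬? (y Data.Fin.≟ u) ×-dec ¬? (Edge? u y)

  universal : ∀ {W u y} → ¬ NonUniversal W u → y ∈ W → y ≢ u → Edge G u y
  universal {u = u} {y} ¬nonUniversal y∈W y≢u with Edge? u y
  ... | yes u~y = u~y
  ... | no u≁y = contradiction (y , y∈W , y≢u , u≁y) ¬nonUniversal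

  SimplicialAwayFrom : Subset n → Fin n → Set
  SimplicialAwayFrom W u = ∃ λ x → x ∈ W × x ≢ u × ¬ Edge G u x × Simplicial W x

  -- C is the component of y₀ in W ∖ N[u] and S the neighbours of u in W that see C. By
  -- chordality S is a clique, and every neighbour of C in W lies in C ∪ S, a proper subset of W.
  module Separation (chordal : Chordal G) {W u y₀} (u∈W : u ∈ W) (y₀∈W : y₀ ∈ W) (y₀≢u : y₀ ≢ u)
                    (u≁y₀ : ¬ Edge G u y₀) where

    R : Subset n
    R = W ─ closedNbhd u

    ∈R⁺ : ∀ {x} → x ∈ W → x ≢ u → ¬ Edge G u x → x ∈ R
    ∈R⁺ x∈W x≢u u≁x = x∈p∧x∉q⇒x∈p─q x∈W ([ u≁x ∘ to x∈tabulate⇔ , x≢u ]′ ∘ x∈p∪⁅y⁆⁻ (nbhd u) u)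

    ∈R⁻ : ∀ {x} → x ∈ R → x ∈ W × x ≢ u × ¬ Edge G u x
    ∈R⁻ x∈R = p─q⊆p W _ x∈R , (λ { refl → x∈p─q⇒x∉q x∈R (x∈p∪⁅x⁆ (nbhd u) u) }) ,
              x∈p─q⇒x∉q x∈R ∘ p⊆p∪q ⁅ u ⁆ ∘ from x∈tabulate⇔

    module Component = Layers R (∈R⁺ y₀∈W y₀≢u u≁y₀)

    C : Subset n
    C = Component.closure

    C⊆R : C ⊆ R
    C⊆R = Component.layer⊆Y n

    Sees : Fin n → Set
    Sees x = x ∈ W × Edge G u x × ∃ λ c → c ∈ C × Edge G x c

    sees? : ∀ x → Dec (Sees x)
    sees? x = x ∈? W ×-dec Edge? u x ×-dec any? (λ c → c ∈? C ×-dec Edge? x c)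

    S : Subset n
    S = toSubset sees?

    -- A missing edge st would close, through u and a shortest path from s to t via C, an induced cycle.
    Sees-nonadjacent-absurd : ∀ {s t} → Sees s → Sees t → s ≢ t → ¬ Edge G s t → Data.Empty.⊥
    Sees-nonadjacent-absurd {s} {t} (_ , u~s , c₁ , c₁∈C , s~c₁) (_ , u~t , c₂ , c₂∈C , t~c₂) s≢t s≁t =
      cycle (Path.shortestPath t∈L)
      where
      Y : Subset n
      Y = (C ∪ ⁅ s ⁆) ∪ ⁅ t ⁆
      ∈Y⁻ : ∀ {x} → x ∈ Y → x ∈ C ⊎ x ≡ s ⊎ x ≡ t
      ∈Y⁻ x∈Y = [ Data.Sum.map₂ inj₁ ∘ x∈p∪⁅y⁆⁻ C s , inj₂ ∘ inj₂ ]′ (x∈p∪⁅y⁆⁻ (C ∪ ⁅ s ⁆) t x∈Y)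
      C⊆Y : C ⊆ Y
      C⊆Y = p⊆p∪q ⁅ t ⁆ ∘ p⊆p∪q ⁅ s ⁆
      module Path = Layers Y (p⊆p∪q ⁅ t ⁆ (x∈p∪⁅x⁆ C s))
      c₁∈L : c₁ ∈ Path.closure
      c₁∈L = Path.closure-closed (Path.layer⊆closure 0 (x∈⁅x⁆ s)) (C⊆Y c₁∈C) s~c₁
      c₂∈L : c₂ ∈ Path.closure
      c₂∈L = Component.connected (_∈ Path.closure) (λ _ y∈C x~y x∈L → Path.closure-closed x∈L (C⊆Y y∈C) x~y)
                                 c₁∈C c₁∈L c₂∈C
      t∈L : t ∈ Path.closure
      t∈L = Path.closure-closed c₂∈L (x∈p∪⁅x⁆ _ t) (Edge-sym t~c₂)
      cycle : (∃ λ j → ∃ λ p → ChordlessPath j p × p 0 ≡ s × p j ≡ t × ∀ {i} → i ≤ j → p i ∈ Y) → Data.Empty.⊥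
      cycle (j , p , path , p₀≡s , pⱼ≡t , p∈Y) =
        chordal (suc (suc j)) (s≤s (s≤s (n≢0∧n≢1⇒2≤n j≢0 j≢1))) (extendAfter p j u ∘ toℕ)
          (chordlessPath+apex⇒InducedCycle path p≢u (subst (Edge G u) (sym p₀≡s) u~s)
                                                  (subst (Edge G u) (sym pⱼ≡t) u~t) u≁interior)
        where
        open ChordlessPath path
        j≢0 : j ≢ 0
        j≢0 refl = s≢t (trans (sym p₀≡s) pⱼ≡t)
        j≢1 : j ≢ 1
        j≢1 refl = s≁t (subst₂ (Edge G) p₀≡s pⱼ≡t (step ≤-refl))
        interior∈C : ∀ {i} → 0 < i → i < j → p i ∈ C
        interior∈C {i} 0<i i<j =
          [ (λ pᵢ∈C → pᵢ∈C)
          , [ (λ pᵢ≡s → contradiction (injective (<⇒≤ i<j) z≤n (trans pᵢ≡s (sym p₀≡s))) (>⇒≢ 0<i))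
            , (λ pᵢ≡t → contradiction (injective (<⇒≤ i<j) ≤-refl (trans pᵢ≡t (sym pⱼ≡t))) (<⇒≢ i<j)) ]′ ]′
          (∈Y⁻ (p∈Y (<⇒≤ i<j)))
        u≁interior : ∀ {i} → 0 < i → i < j → ¬ Edge G u (p i)
        u≁interior 0<i i<j = proj₂ (proj₂ (∈R⁻ (C⊆R (interior∈C 0<i i<j))))
        p≢u : ∀ {i} → i ≤ j → p i ≢ u
        p≢u i≤j pᵢ≡u =
          [ (λ pᵢ∈C → proj₁ (proj₂ (∈R⁻ (C⊆R pᵢ∈C))) pᵢ≡u)
          , [ (λ pᵢ≡s → irrefl G u (subst (Edge G u) (trans (sym pᵢ≡s) pᵢ≡u) u~s))
            , (λ pᵢ≡t → irrefl G u (subst (Edge G u) (trans (sym pᵢ≡t) pᵢ≡u) u~t)) ]′ ]′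
          (∈Y⁻ (p∈Y i≤j))

    S-clique : ∀ {s t} → s ∈ S → t ∈ S → s ≢ t → Edge G s t
    S-clique {s} {t} s∈S t∈S s≢t with Edge? s t
    ... | yes s~t = s~t
    ... | no s≁t =
      Data.Empty.⊥-elim
        (Sees-nonadjacent-absurd (to (x∈toSubset⇔ sees?) s∈S) (to (x∈toSubset⇔ sees?) t∈S) s≢t s≁t)

    W′ : Subset n
    W′ = C ∪ S

    ∣W′∣<∣W∣ : ∣ W′ ∣ < ∣ W ∣
    ∣W′∣<∣W∣ = ≤-<-trans (p⊆q⇒∣p∣≤∣q∣ W′⊆W-u) (x∈p⇒∣p-x∣<∣p∣ u∈W)
      where
      W′⊆W-u : W′ ⊆ W - u
      W′⊆W-u x∈W′ with x∈p∪q⁻ C S x∈W′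
      ... | inj₁ x∈C = p⊆r∧s⊆q⇒p─q⊆r─s (λ x∈W → x∈W) (q⊆p∪q (nbhd u) ⁅ u ⁆) (C⊆R x∈C)
      ... | inj₂ x∈S with to (x∈toSubset⇔ sees?) x∈S
      ...   | x∈W , u~x , _ = x∈p∧x≢y⇒x∈p-y x∈W (λ { refl → irrefl G u u~x })

    nbhd-C⊆W′ : ∀ {x y} → x ∈ C → y ∈ W → Edge G x y → y ∈ W′
    nbhd-C⊆W′ {x} {y} x∈C y∈W x~y with Edge? u y
    ... | yes u~y = q⊆p∪q C S (from (x∈toSubset⇔ sees?) (y∈W , u~y , x , x∈C , Edge-sym x~y))
    ... | no u≁y = p⊆p∪q S (Component.closure-closed x∈C (∈R⁺ y∈W y≢u u≁y) x~y)
      where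
      y≢u : y ≢ u
      y≢u refl = proj₂ (proj₂ (∈R⁻ (C⊆R x∈C))) (Edge-sym x~y)

    lift : ∀ {x} → x ∈ C → Simplicial W′ x → SimplicialAwayFrom W u
    lift x∈C simplicial with ∈R⁻ (C⊆R x∈C)
    ... | x∈W , x≢u , u≁x = _ , x∈W , x≢u , u≁x ,
      λ y∈W z∈W x~y x~z y≢z → simplicial (nbhd-C⊆W′ x∈C y∈W x~y) (nbhd-C⊆W′ x∈C z∈W x~z) x~y x~z y≢z

    ∈C : ∀ {x} → x ∈ W′ → x ∉ S → x ∈ C
    ∈C x∈W′ x∉S = [ (λ x∈C → x∈C) , (λ x∈S → contradiction x∈S x∉S) ]′ (x∈p∪q⁻ C S x∈W′)

    -- The simplicial vertex found in W′ avoids the clique S, hence lies in C.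
    fromSmaller : (∀ {u′} → u′ ∈ W′ → NonUniversal W′ u′ → SimplicialAwayFrom W′ u′) → SimplicialAwayFrom W u
    fromSmaller smaller with any? (λ u′ → u′ ∈? S ×-dec NonUniversal? W′ u′)
    ... | yes (u′ , u′∈S , nonUniversal) with smaller (q⊆p∪q C S u′∈S) nonUniversal
    ...   | x , x∈W′ , x≢u′ , u′≁x , simplicial =
      lift (∈C x∈W′ (λ x∈S → u′≁x (S-clique u′∈S x∈S (x≢u′ ∘ sym)))) simplicial
    fromSmaller smaller | no S-universal with any? (λ u′ → u′ ∈? W′ ×-dec NonUniversal? W′ u′)
    ... | yes (u′ , u′∈W′ , nonUniversal) with smaller u′∈W′ nonUniversal
    ...   | x , x∈W′ , x≢u′ , u′≁x , simplicial =
      lift (∈C x∈W′ λ x∈S →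
              u′≁x (Edge-sym (universal (λ nu → S-universal (x , x∈S , nu)) u′∈W′ (x≢u′ ∘ sym))))
           simplicial
    fromSmaller smaller | no S-universal | no complete =
      lift (Component.layer⊆closure 0 (x∈⁅x⁆ y₀)) λ y∈W′ z∈W′ _ _ y≢z →
        universal (λ nu → complete (_ , y∈W′ , nu)) z∈W′ (y≢z ∘ sym)

  simplicialAwayFrom : Chordal G → ∀ b {W u} → ∣ W ∣ ≤ b → u ∈ W → NonUniversal W u → SimplicialAwayFrom W u
  simplicialAwayFrom _ zero ∣W∣≤0 u∈W _ = contradiction (≤-trans (x∈p⇒∣p-x∣<∣p∣ u∈W) ∣W∣≤0) λ ()
  simplicialAwayFrom chordal (suc b) ∣W∣≤1+b u∈W (y₀ , y₀∈W , y₀≢u , u≁y₀) =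
    fromSmaller (simplicialAwayFrom chordal b (≤-pred (≤-trans ∣W′∣<∣W∣ ∣W∣≤1+b)))
    where open Separation chordal u∈W y₀∈W y₀≢u u≁y₀

  chordal⇒HasSimplicialVertices : Chordal G → HasSimplicialVertices
  chordal⇒HasSimplicialVertices chordal W (x , x∈W) with any? (λ u → u ∈? W ×-dec NonUniversal? W u)
  ... | yes (u , u∈W , nonUniversal) with simplicialAwayFrom chordal n (∣p∣≤n W) u∈W nonUniversal
  ...   | v , v∈W , _ , _ , simplicial = v , v∈W , simplicial
  chordal⇒HasSimplicialVertices chordal W (x , x∈W) | no complete =
    x , x∈W , λ y∈W z∈W _ _ y≢z → universal (λ nu → complete (_ , y∈W , nu)) z∈W (y≢z ∘ sym)

theorem4p12 : ∀ {n} (G : Graph n) → Chordal G → ∀ (k : ℕ) → 2 ≤ k →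
    VertexDecomposable (TotalCut k G) × Shellable (TotalCut k G)
theorem4p12 {n} G chordal k _ = decomposable , VertexDecomposable⇒Shellable closed decomposable
  where
  TotalCut≋RestrictedCut : TotalCut k G ≋ RestrictedCut G ⊤ ⊤ k
  TotalCut≋RestrictedCut σ =
    mk⇔ (λ (S , independent , ∣S∣≡k , S⊆∁σ) → ⊆⊤ , S , independent , ∣S∣≡k , ⊆⊤ , S⊆∁σ)
        (λ (_ , S , independent , ∣S∣≡k , _ , S⊆∁σ) → S , independent , ∣S∣≡k , S⊆∁σ)
  decomposable : VertexDecomposable (TotalCut k G)
  decomposable = VertexDecomposable-resp (≋-sym TotalCut≋RestrictedCut)
    (RestrictedCut-vertexDecomposable G (chordal⇒HasSimplicialVertices G chordal) n k (∣p∣≤n ⊤) ⊆⊤)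
  closed : DownClosed (TotalCut k G)
  closed σ⊆τ (S , independent , ∣S∣≡k , S⊆∁τ) = S , independent , ∣S∣≡k , p⊆q⇒∁p⊇∁q σ⊆τ ∘ S⊆∁τ
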